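{- Let $(g,f)=(d_{n,k})_{n,k\ge0}$ be a Riordan array with $f(t)=\sum_{j\ge1}f_jt^j$. Let $c=(c_0,c_1,\dots)$ with $c_0=1$ and $c_k\ne0$ for all $k$, and let $C=(c_{n,k})_{n,k\ge0}$ be lower triangular with $c_{n,0}=1$, $c_{n,k}\ne0$ for $0\le k\le n$ and $c_{n,k}=0$ for $k>n$. Put $d^{(c)}_{n,k}=\frac{c_n}{c_k}d_{n,k}$ and $d^{(C)}_{n,k}=\frac{c_{n,n}}{c_{n,k}}d_{n,k}$. Then for all $n,k\ge1$, $$d^{(c)}_{n,k}=\frac{c_n}{c_k}\sum_{j=1}^{n-k+1}f_j\frac{c_{k-1}}{c_{n-j}}d^{(c)}_{n-j,k-1}\quad\text{and}\quad d^{(C)}_{n,k}=\frac{c_{n,n}}{c_{n,k}}\sum_{j=1}^{n-k+1}f_j\frac{c_{n-j,k-1}}{c_{n-j,n-j}}d^{(C)}_{n-j,k-1}.$$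
   Context: $\mathbb{K}$ is $\mathbb{R}$ or $\mathbb{C}$. For $g\in\mathbb{K}[[t]]$ with $g(0)=1$ and $f\in\mathbb{K}[[t]]$ with $f(0)=0\ne f'(0)$, the Riordan array $(g,f)=(d_{n,k})_{n,k\ge0}$ is the infinite lower triangular matrix with $d_{n,k}=[t^n]g(t)f(t)^k$. The matrices $(d^{(c)}_{n,k})$ and $(d^{(C)}_{n,k})$ are called the $(c)$-Riordan array and $(C)$-Riordan array of $(g,f)$. -}

module Defs where

open import Level using (Level; _⊔_) renaming (suc to lsuc)
open import Data.Nat using (ℕ; zero; suc; _∸_)
open import Relation.Nullary using (¬_)
open import Algebra.Bundles using (CommutativeRing)

-- The inverse is given as a total
-- function 'inv' whose value at 0# is irrelevant (only used at nonzero
-- arguments in the statement); this makes the quotients c_n / c_k etc.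
-- expressible as c_n * inv c_k.
record Field (c ℓ : Level) : Set (lsuc (c ⊔ ℓ)) where
  field
    commutativeRing : CommutativeRing c ℓ
  open CommutativeRing commutativeRing public
  field
    inv     : Carrier → Carrier
    inverse : ∀ x → ¬ (x ≈ 0#) → x * inv x ≈ 1#
    0≉1     : ¬ (0# ≈ 1#)

module FieldOps {c ℓ : Level} (F : Field c ℓ) where
  open Field F

  Series : Set c
  Series = ℕ → Carrier

  Σ0 : ℕ → (ℕ → Carrier) → Carrier
  Σ0 zero    h = h 0
  Σ0 (suc m) h = Σ0 m h + h (suc m)

  Σ1 : ℕ → (ℕ → Carrier) → Carrier
  Σ1 zero    h = 0#
  Σ1 (suc m) h = Σ1 m h + h (suc m)

  _⋆_ : Series → Series → Series
  (a ⋆ b) n = Σ0 n (λ i → a i * b (n ∸ i))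

  one : Series
  one zero    = 1#
  one (suc _) = 0#

  pow : Series → ℕ → Series
  pow f zero    = one
  pow f (suc k) = f ⋆ pow f k

  riordan : Series → Series → ℕ → ℕ → Carrier
  riordan g f n k = (g ⋆ pow f k) n

  riordanc : (ℕ → Carrier) → Series → Series → ℕ → ℕ → Carrier
  riordanc cs g f n k = (cs n * inv (cs k)) * riordan g f n k

  riordanC : (ℕ → ℕ → Carrier) → Series → Series → ℕ → ℕ → Carrier
  riordanC C g f n k = (C n n * inv (C n k)) * riordan g f n k

{-# OPTIONS --safe #-}
-- Since g f^{k+1} = f · (g f^k), the entry d_{n,k+1} is the Cauchy coefficient
-- Σ_{j=0}^{n} f_j d_{n-j,k}.  The j = 0 term vanishes because f_0 = 0, and the terms with
-- j > n - k vanish because f^k, hence g f^k, has order at least k; this is the classical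
-- recurrence d_{n,k+1} = Σ_{j=1}^{n-k} f_j d_{n-j,k}.  Both rescaled arrays multiply d_{m,l}
-- by a nonzero factor p_m / q_{m,l}, and the recurrence is transported to them by inserting
-- q_{m,k} / p_m · p_m / q_{m,k} = 1 in every term.
module Submission where

open import Level using (Level)
open import Data.Nat as ℕ using (ℕ; zero; suc; _∸_; _≤_; _<_; z≤n; s≤s)
open import Data.Nat.Properties as ℕₚ
  using ( ≤-refl; ≤-reflexive; <-≤-trans; ≤-<-trans; <⇒≤; m≤n⇒m≤1+n; m≤n⇒m<n∨m≡n
        ; +-∸-assoc; m∸n≤m; m∸[m∸n]≡n; n∸n≡0; ∸-monoʳ-≤; m≤n+o⇒m∸n≤o
        ; ≮⇒≥; m≤n+m∸n; +-monoʳ-<; m∸n≢0⇒n<m; m<n⇒n≢0; m≤o∸n⇒m+n≤o; m+n≤o⇒m≤o∸n )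
open import Data.Product using (_×_; _,_)
open import Data.Sum using (inj₁; inj₂)
open import Relation.Nullary using (¬_; yes; no)
open import Relation.Binary.PropositionalEquality as ≡ using (_≡_)
import Algebra.Properties.CommutativeSemigroup as CommutativeSemigroupProperties

open import Defs

m<n+o⇒m∸l<o : ∀ {m n o l} → m < n ℕ.+ o → n ≤ l → l ≤ m → m ∸ l < o
m<n+o⇒m∸l<o {m} {n} {o} {l} m<n+o n≤l l≤m = begin-strict
  m ∸ l       <⟨ ≤-reflexive (≡.sym (+-∸-assoc 1 l≤m)) ⟩
  suc m ∸ l   ≤⟨ ∸-monoʳ-≤ (suc m) n≤l ⟩
  suc m ∸ n   ≤⟨ m≤n+o⇒m∸n≤o (suc m) n m<n+o ⟩
  o           ∎
  where open ℕₚ.≤-Reasoning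

m∸n<o⇒m∸o<n : ∀ {m n o} → m ∸ n < o → o ≤ m → m ∸ o < n
m∸n<o⇒m∸o<n {m} {n} {o} m∸n<o o≤m = m<n+o⇒m∸l<o m<o+n ≤-refl o≤m
  where
  m<o+n : m < o ℕ.+ n
  m<o+n = ≡.subst (m <_) (ℕₚ.+-comm n o) (≤-<-trans (m≤n+m∸n m n) (+-monoʳ-< n m∸n<o))

0<m≤n∸o⇒o≤n∸m : ∀ {m n o} → 0 < m → m ≤ n ∸ o → o ≤ n ∸ m
0<m≤n∸o⇒o≤n∸m {m} {n} {o} 0<m m≤n∸o =
  m+n≤o⇒m≤o∸n o (≡.subst (_≤ n) (ℕₚ.+-comm m o) (m≤o∸n⇒m+n≤o m o≤n m≤n∸o))
  where
  o≤n : o ≤ n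
  o≤n = <⇒≤ (m∸n≢0⇒n<m (m<n⇒n≢0 (<-≤-trans 0<m m≤n∸o)))

module RiordanRecurrence {c ℓ : Level} (F : Field c ℓ) where
  open Field F
  open FieldOps F
  open import Relation.Binary.Reasoning.Setoid setoid
  open CommutativeSemigroupProperties +-commutativeSemigroup using (interchange)
  open CommutativeSemigroupProperties *-commutativeSemigroup
    using () renaming (interchange to *-interchange)

  Σ0-cong : ∀ n {h h′} → (∀ i → i ≤ n → h i ≈ h′ i) → Σ0 n h ≈ Σ0 n h′
  Σ0-cong zero    h≈h′ = h≈h′ 0 z≤n
  Σ0-cong (suc n) h≈h′ = +-cong (Σ0-cong n (λ i i≤n → h≈h′ i (m≤n⇒m≤1+n i≤n))) (h≈h′ (suc n) ≤-refl)

  Σ1-cong : ∀ n {h h′} → (∀ i → 0 < i → i ≤ n → h i ≈ h′ i) → Σ1 n h ≈ Σ1 n h′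
  Σ1-cong zero    h≈h′ = refl
  Σ1-cong (suc n) h≈h′ =
    +-cong (Σ1-cong n (λ i 0<i i≤n → h≈h′ i 0<i (m≤n⇒m≤1+n i≤n))) (h≈h′ (suc n) (s≤s z≤n) ≤-refl)

  Σ0-≈0 : ∀ n {h} → (∀ i → i ≤ n → h i ≈ 0#) → Σ0 n h ≈ 0#
  Σ0-≈0 zero    h≈0 = h≈0 0 z≤n
  Σ0-≈0 (suc n) h≈0 =
    trans (+-cong (Σ0-≈0 n (λ i i≤n → h≈0 i (m≤n⇒m≤1+n i≤n))) (h≈0 (suc n) ≤-refl)) (+-identityˡ 0#)

  Σ0-+ : ∀ n h h′ → Σ0 n (λ i → h i + h′ i) ≈ Σ0 n h + Σ0 n h′
  Σ0-+ zero    h h′ = refl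
  Σ0-+ (suc n) h h′ = trans (+-cong (Σ0-+ n h h′) refl) (interchange _ _ _ _)

  Σ0-*ˡ : ∀ n x h → Σ0 n (λ i → x * h i) ≈ x * Σ0 n h
  Σ0-*ˡ zero    x h = refl
  Σ0-*ˡ (suc n) x h = trans (+-cong (Σ0-*ˡ n x h) refl) (sym (distribˡ x _ _))

  Σ0≈head+Σ1 : ∀ n h → Σ0 n h ≈ h 0 + Σ1 n h
  Σ0≈head+Σ1 zero    h = sym (+-identityʳ _)
  Σ0≈head+Σ1 (suc n) h = trans (+-cong (Σ0≈head+Σ1 n h) refl) (+-assoc _ _ _)

  Σ0-suc : ∀ n h → Σ0 (suc n) h ≈ h 0 + Σ0 n (λ i → h (suc i))
  Σ0-suc zero    h = refl
  Σ0-suc (suc n) h = trans (+-cong (Σ0-suc n h) refl) (+-assoc _ _ _)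

  Σ0-reverse : ∀ n h → Σ0 n h ≈ Σ0 n (λ i → h (n ∸ i))
  Σ0-reverse zero    h = refl
  Σ0-reverse (suc n) h = begin
    Σ0 (suc n) h                               ≈⟨ Σ0-suc n h ⟩
    h 0 + Σ0 n (λ i → h (suc i))               ≈⟨ +-cong refl (Σ0-reverse n (λ i → h (suc i))) ⟩
    h 0 + Σ0 n (λ i → h (suc (n ∸ i)))         ≈⟨ +-cong refl (Σ0-cong n (λ i i≤n →
                                                    reflexive (≡.cong h (≡.sym (+-∸-assoc 1 i≤n))))) ⟩
    h 0 + Σ0 n (λ i → h (suc n ∸ i))           ≈⟨ +-comm _ _ ⟩
    Σ0 n (λ i → h (suc n ∸ i)) + h 0           ≈⟨ +-cong refl (reflexive (≡.cong h (≡.sym (n∸n≡0 n)))) ⟩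
    Σ0 n (λ i → h (suc n ∸ i)) + h (suc n ∸ suc n) ∎

  Σ1-truncate : ∀ n m h → m ≤ n → (∀ j → m < j → j ≤ n → h j ≈ 0#) → Σ1 n h ≈ Σ1 m h
  Σ1-truncate zero    m h z≤n h≈0 = refl
  Σ1-truncate (suc n) m h m≤n h≈0 with m≤n⇒m<n∨m≡n m≤n
  ... | inj₂ ≡.refl      = refl
  ... | inj₁ (s≤s m≤n′) =
    trans (+-cong (Σ1-truncate n m h m≤n′ (λ j m<j j≤n → h≈0 j m<j (m≤n⇒m≤1+n j≤n)))
                  (h≈0 (suc n) (s≤s m≤n′) ≤-refl))
          (+-identityʳ _)

  shift : Series → Series
  shift a i = a (suc i)

  ⋆-comm : ∀ a b n → (a ⋆ b) n ≈ (b ⋆ a) n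
  ⋆-comm a b n = trans (Σ0-reverse n _) (Σ0-cong n (λ i i≤n →
    trans (*-comm _ _) (*-cong (reflexive (≡.cong b (m∸[m∸n]≡n i≤n))) refl)))

  ⋆-congˡ : ∀ {a a′} b n → (∀ i → a i ≈ a′ i) → (a ⋆ b) n ≈ (a′ ⋆ b) n
  ⋆-congˡ b n a≈a′ = Σ0-cong n (λ i _ → *-cong (a≈a′ i) refl)

  ⋆-suc : ∀ a b n → (a ⋆ b) (suc n) ≈ a 0 * b (suc n) + (shift a ⋆ b) n
  ⋆-suc a b n = Σ0-suc n _

  ⋆-linearˡ : ∀ x a a′ b n → ((λ i → x * a i + a′ i) ⋆ b) n ≈ x * (a ⋆ b) n + (a′ ⋆ b) n
  ⋆-linearˡ x a a′ b n = begin
    Σ0 n (λ i → (x * a i + a′ i) * b (n ∸ i))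
      ≈⟨ Σ0-cong n (λ i _ → trans (distribʳ _ _ _) (+-cong (*-assoc _ _ _) refl)) ⟩
    Σ0 n (λ i → x * (a i * b (n ∸ i)) + a′ i * b (n ∸ i))  ≈⟨ Σ0-+ n _ _ ⟩
    Σ0 n (λ i → x * (a i * b (n ∸ i))) + (a′ ⋆ b) n        ≈⟨ +-cong (Σ0-*ˡ n x _) refl ⟩
    x * (a ⋆ b) n + (a′ ⋆ b) n                             ∎

  ⋆-assoc : ∀ a b d n → ((a ⋆ b) ⋆ d) n ≈ (a ⋆ (b ⋆ d)) n
  ⋆-assoc a b d zero    = *-assoc _ _ _
  ⋆-assoc a b d (suc n) = begin
    ((a ⋆ b) ⋆ d) (suc n)
      ≈⟨ ⋆-suc (a ⋆ b) d n ⟩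
    (a 0 * b 0) * d (suc n) + (shift (a ⋆ b) ⋆ d) n
      ≈⟨ +-cong refl (⋆-congˡ d n (⋆-suc a b)) ⟩
    (a 0 * b 0) * d (suc n) + ((λ i → a 0 * shift b i + (shift a ⋆ b) i) ⋆ d) n
      ≈⟨ +-cong refl (⋆-linearˡ (a 0) (shift b) (shift a ⋆ b) d n) ⟩
    (a 0 * b 0) * d (suc n) + (a 0 * (shift b ⋆ d) n + ((shift a ⋆ b) ⋆ d) n)
      ≈⟨ +-cong refl (+-cong refl (⋆-assoc (shift a) b d n)) ⟩
    (a 0 * b 0) * d (suc n) + (a 0 * (shift b ⋆ d) n + (shift a ⋆ (b ⋆ d)) n)
      ≈⟨ sym (+-assoc _ _ _) ⟩
    ((a 0 * b 0) * d (suc n) + a 0 * (shift b ⋆ d) n) + (shift a ⋆ (b ⋆ d)) n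
      ≈⟨ +-cong (trans (+-cong (*-assoc _ _ _) refl) (sym (distribˡ _ _ _))) refl ⟩
    a 0 * (b 0 * d (suc n) + (shift b ⋆ d) n) + (shift a ⋆ (b ⋆ d)) n
      ≈⟨ +-cong (*-cong refl (sym (⋆-suc b d n))) refl ⟩
    a 0 * (b ⋆ d) (suc n) + (shift a ⋆ (b ⋆ d)) n
      ≈⟨ sym (⋆-suc a (b ⋆ d) n) ⟩
    (a ⋆ (b ⋆ d)) (suc n) ∎

  ⋆-leftComm : ∀ a b d n → (a ⋆ (b ⋆ d)) n ≈ (b ⋆ (a ⋆ d)) n
  ⋆-leftComm a b d n = begin
    (a ⋆ (b ⋆ d)) n  ≈⟨ sym (⋆-assoc a b d n) ⟩
    ((a ⋆ b) ⋆ d) n  ≈⟨ ⋆-congˡ d n (⋆-comm a b) ⟩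
    ((b ⋆ a) ⋆ d) n  ≈⟨ ⋆-assoc b a d n ⟩
    (b ⋆ (a ⋆ d)) n  ∎

  VanishesBelow : ℕ → Series → Set ℓ
  VanishesBelow k a = ∀ m → m < k → a m ≈ 0#

  ⋆-vanishesBelow : ∀ {i j a b} → VanishesBelow i a → VanishesBelow j b →
                    VanishesBelow (i ℕ.+ j) (a ⋆ b)
  ⋆-vanishesBelow {i} {j} {a} {b} a≈0 b≈0 m m<i+j = Σ0-≈0 m term≈0
    where
    term≈0 : ∀ l → l ≤ m → a l * b (m ∸ l) ≈ 0#
    term≈0 l l≤m with l ℕ.<? i
    ... | yes l<i = trans (*-cong (a≈0 l l<i) refl) (zeroˡ _)
    ... | no  l≮i = trans (*-cong refl (b≈0 (m ∸ l) (m<n+o⇒m∸l<o m<i+j (≮⇒≥ l≮i) l≤m))) (zeroʳ _)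

  pow-vanishesBelow : ∀ {f} → VanishesBelow 1 f → ∀ k → VanishesBelow k (pow f k)
  pow-vanishesBelow f≈0 zero    m ()
  pow-vanishesBelow f≈0 (suc k) = ⋆-vanishesBelow f≈0 (pow-vanishesBelow f≈0 k)

  riordan-lowerTriangular : ∀ g f → f 0 ≈ 0# → ∀ m k → m < k → riordan g f m k ≈ 0#
  riordan-lowerTriangular g f f₀≈0 m k =
    ⋆-vanishesBelow {0} {a = g} (λ _ ()) (pow-vanishesBelow (λ { 0 (s≤s z≤n) → f₀≈0 }) k) m

  riordan-suc : ∀ g f → f 0 ≈ 0# → ∀ n k →
                riordan g f n (suc k) ≈ Σ1 (n ∸ k) (λ j → f j * riordan g f (n ∸ j) k)
  riordan-suc g f f₀≈0 n k = begin
    riordan g f n (suc k)                                              ≈⟨ ⋆-leftComm g f (pow f k) n ⟩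
    Σ0 n (λ j → f j * riordan g f (n ∸ j) k)                           ≈⟨ Σ0≈head+Σ1 n _ ⟩
    f 0 * riordan g f n k + Σ1 n (λ j → f j * riordan g f (n ∸ j) k)   ≈⟨ +-cong f₀d≈0 refl ⟩
    0# + Σ1 n (λ j → f j * riordan g f (n ∸ j) k)                      ≈⟨ +-identityˡ _ ⟩
    Σ1 n (λ j → f j * riordan g f (n ∸ j) k)
      ≈⟨ Σ1-truncate n (n ∸ k) _ (m∸n≤m n k) beyond≈0 ⟩
    Σ1 (n ∸ k) (λ j → f j * riordan g f (n ∸ j) k)                     ∎
    where
    f₀d≈0 : f 0 * riordan g f n k ≈ 0#
    f₀d≈0 = trans (*-cong f₀≈0 refl) (zeroˡ _)
    beyond≈0 : ∀ j → n ∸ k < j → j ≤ n → f j * riordan g f (n ∸ j) k ≈ 0#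
    beyond≈0 j n∸k<j j≤n =
      trans (*-cong refl (riordan-lowerTriangular g f f₀≈0 (n ∸ j) k (m∸n<o⇒m∸o<n n∸k<j j≤n))) (zeroʳ _)

  quotient-cancel : ∀ {a b} → ¬ (a ≈ 0#) → ¬ (b ≈ 0#) → ∀ d → (a * inv b) * ((b * inv a) * d) ≈ d
  quotient-cancel {a} {b} a≉0 b≉0 d = begin
    (a * inv b) * ((b * inv a) * d)  ≈⟨ sym (*-assoc _ _ _) ⟩
    ((a * inv b) * (b * inv a)) * d  ≈⟨ *-cong (*-cong refl (*-comm b (inv a))) refl ⟩
    ((a * inv b) * (inv a * b)) * d  ≈⟨ *-cong (*-interchange a (inv b) (inv a) b) refl ⟩
    ((a * inv a) * (inv b * b)) * d  ≈⟨ *-cong (*-cong (inverse a a≉0) (trans (*-comm _ _) (inverse b b≉0))) refl ⟩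
    (1# * 1#) * d                    ≈⟨ trans (*-cong (*-identityˡ 1#) refl) (*-identityˡ d) ⟩
    d                                ∎

  rescaled-riordan-suc :
    ∀ g f → f 0 ≈ 0# → (p : ℕ → Carrier) (q : ℕ → ℕ → Carrier) → ∀ n k →
    (∀ m → k ≤ m → ¬ (p m ≈ 0#)) → (∀ m → k ≤ m → ¬ (q m k ≈ 0#)) →
    let e = λ m l → (p m * inv (q m l)) * riordan g f m l in
    e n (suc k) ≈ (p n * inv (q n (suc k))) *
                  Σ1 (n ∸ k) (λ j → f j * ((q (n ∸ j) k * inv (p (n ∸ j))) * e (n ∸ j) k))
  rescaled-riordan-suc g f f₀≈0 p q n k p≉0 q≉0 =
    *-cong refl (trans (riordan-suc g f f₀≈0 n k) (Σ1-cong (n ∸ k) insert-factors))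
    where
    insert-factors : ∀ j → 0 < j → j ≤ n ∸ k → f j * riordan g f (n ∸ j) k ≈
                     f j * ((q (n ∸ j) k * inv (p (n ∸ j))) * ((p (n ∸ j) * inv (q (n ∸ j) k)) * riordan g f (n ∸ j) k))
    insert-factors j 0<j j≤n∸k = *-cong refl (sym (quotient-cancel (q≉0 (n ∸ j) k≤n∸j) (p≉0 (n ∸ j) k≤n∸j) _))
      where
      k≤n∸j : k ≤ n ∸ j
      k≤n∸j = 0<m≤n∸o⇒o≤n∸m 0<j j≤n∸k

theorem4p7 : ∀ {a ℓ} (F : Field a ℓ) →
  let open Field F
      open FieldOps F
  in (g f : Series) → g 0 ≈ 1# → f 0 ≈ 0# → ¬ (f 1 ≈ 0#) →
     (c : ℕ → Carrier) → c 0 ≈ 1# → (∀ k → ¬ (c k ≈ 0#)) →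
     (C : ℕ → ℕ → Carrier) → (∀ n → C n 0 ≈ 1#) →
     (∀ n k → k ≤ n → ¬ (C n k ≈ 0#)) → (∀ n k → n < k → C n k ≈ 0#) →
     ∀ n k → 1 ≤ n → 1 ≤ k →
       (riordanc c g f n k
          ≈ (c n * inv (c k)) *
            Σ1 (suc n ∸ k) (λ j → f j * ((c (k ∸ 1) * inv (c (n ∸ j))) * riordanc c g f (n ∸ j) (k ∸ 1))))
       ×
       (riordanC C g f n k
          ≈ (C n n * inv (C n k)) *
            Σ1 (suc n ∸ k) (λ j → f j * ((C (n ∸ j) (k ∸ 1) * inv (C (n ∸ j) (n ∸ j))) * riordanC C g f (n ∸ j) (k ∸ 1))))
theorem4p7 F g f _ f₀≈0 _ c _ c≉0 C _ C≉0 _ n (suc k) _ _ =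
  rescaled-riordan-suc g f f₀≈0 c (λ _ → c) n k (λ m _ → c≉0 m) (λ _ _ → c≉0 k) ,
  rescaled-riordan-suc g f f₀≈0 (λ m → C m m) C n k (λ m _ → C≉0 m m ≤-refl) (λ m → C≉0 m k)
  where open RiordanRecurrence F
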